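{- For every graph $G$, let $M = M(G)$ be the graph obtained from $G$ by adding, for each vertex $v \in V(G)$, a new vertex $v'$ and the edge $vv'$. Then $\alpha\text{ - }tw(G) = \mu\text{ - }tw(M)$.
   Context: Graphs are finite and simple. A tree decomposition of a graph $G$ is a pair $(T,\{B_t\}_{t\in V(T)})$ where $T$ is a tree and each $B_t \subseteq V(G)$, such that for every vertex $x$ the nodes $t$ with $x \in B_t$ induce a connected subtree of $T$, and every edge of $G$ is contained in some bag. For $S \subseteq V(G)$, $\mu_G(S)$ is the maximum size of an induced matching $M$ of $G$ such that every edge of $M$ intersects $S$, and $\alpha_G(S) = \alpha(G[S])$. For $\lambda \in \{\mu,\alpha\}$, the $\lambda$-width of a decomposition is $\max_t\lambda_G(B_t)$ and $\lambda\text{ - }tw(G)$ is the minimum $\lambda$-width over all tree decompositions of $G$. -}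

module Defs where

open import Data.Nat using (ℕ; zero; suc; _+_; _≤_; _<_)
open import Data.Fin using (Fin; zero; suc; splitAt; inject₁; fromℕ)
open import Data.Fin.Subset using (Subset; _∈_; _⊆_; ∣_∣)
open import Data.List using (List; []; _∷_; length; concatMap)
open import Data.List.Relation.Unary.All using (All)
open import Data.List.Relation.Unary.Unique.Propositional using (Unique)
import Data.List.Membership.Propositional as L
open import Data.Product using (Σ; ∃; _×_; _,_)
open import Data.Sum using (_⊎_; inj₁; inj₂)
open import Data.Unit using (⊤)
open import Data.Empty using (⊥)
open import Relation.Nullary using (¬_)
open import Relation.Binary.PropositionalEquality using (_≡_; refl; sym)
open import Function.Definitions using (Injective)

record Graph (n : ℕ) : Set₁ where
  field
    E      : Fin n → Fin n → Set
    E-sym  : ∀ {x y} → E x y → E y x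
    irrefl : ∀ {x} → ¬ E x x
open Graph public

data Walk {m : ℕ} (T : Graph m) (P : Fin m → Set) : Fin m → Fin m → Set where
  here : ∀ {x} → P x → Walk T P x x
  step : ∀ {x y z} → P x → E T x y → Walk T P y z → Walk T P x z

ConnectedIn : ∀ {m} → Graph m → (Fin m → Set) → Set
ConnectedIn T P = (∃ λ t → P t) × (∀ s t → P s → P t → Walk T P s t)

-- a cycle of length 3 + k: injective cyclic sequence of adjacent vertices
Cycle : ∀ {m} → Graph m → Set
Cycle {m} T =
  Σ ℕ λ k → Σ (Fin (suc (suc (suc k))) → Fin m) λ c →
    Injective _≡_ _≡_ c ×
    (∀ (i : Fin (suc (suc k))) → E T (c (inject₁ i)) (c (suc i))) ×
    E T (c (fromℕ (suc (suc k)))) (c zero)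

IsTree : ∀ {m} → Graph m → Set
IsTree T = ConnectedIn T (λ _ → ⊤) × ¬ Cycle T

record TreeDecomposition {n : ℕ} (G : Graph n) : Set₁ where
  field
    m       : ℕ
    T       : Graph m
    isTree  : IsTree T
    bag     : Fin m → Subset n
    vertexC : ∀ (x : Fin n) → ConnectedIn T (λ t → x ∈ bag t)
    edgeC   : ∀ x y → E G x y → ∃ λ t → x ∈ bag t × y ∈ bag t
open TreeDecomposition public

Independent : ∀ {n} → Graph n → Subset n → Set
Independent G I = ∀ x y → x ∈ I → y ∈ I → ¬ E G x y

αLe : ∀ {n} → Graph n → Subset n → ℕ → Set
αLe {n} G S k = ∀ (I : Subset n) → I ⊆ S → Independent G I → ∣ I ∣ ≤ k

endpoints : ∀ {n} → List (Fin n × Fin n) → List (Fin n)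
endpoints = concatMap (λ { (u , v) → u ∷ v ∷ [] })

InducedMatching : ∀ {n} → Graph n → List (Fin n × Fin n) → Set
InducedMatching G M =
  All (λ { (u , v) → E G u v }) M ×
  Unique (endpoints M) ×
  (∀ x y → x L.∈ endpoints M → y L.∈ endpoints M → E G x y →
     ((x , y) L.∈ M) ⊎ ((y , x) L.∈ M))

μLe : ∀ {n} → Graph n → Subset n → ℕ → Set
μLe {n} G S k = ∀ (M : List (Fin n × Fin n)) → InducedMatching G M →
  All (λ { (u , v) → (u ∈ S) ⊎ (v ∈ S) }) M → length M ≤ k

Measure : Set₁
Measure = ∀ {n} → Graph n → Subset n → ℕ → Set

TwLe : Measure → ∀ {n} → Graph n → ℕ → Set₁
TwLe λLe G k = Σ (TreeDecomposition G) λ D → ∀ t → λLe G (bag D t) k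

IsTw : Measure → ∀ {n} → Graph n → ℕ → Set₁
IsTw λLe G k = TwLe λLe G k × (∀ k′ → TwLe λLe G k′ → k ≤ k′)

α-tw≡ μ-tw≡ : ∀ {n} → Graph n → ℕ → Set₁
α-tw≡ = IsTw αLe
μ-tw≡ = IsTw μLe

-- M(G): add a pendant vertex v' to every v.  Vertices: Fin (n + n),
-- first copy = V(G), second copy = the new vertices v'.

MAdj : ∀ {n} → Graph n → Fin n ⊎ Fin n → Fin n ⊎ Fin n → Set
MAdj G (inj₁ u) (inj₁ v) = E G u v
MAdj G (inj₁ u) (inj₂ v) = u ≡ v
MAdj G (inj₂ u) (inj₁ v) = u ≡ v
MAdj G (inj₂ u) (inj₂ v) = ⊥

MAdj-sym : ∀ {n} (G : Graph n) a b → MAdj G a b → MAdj G b a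
MAdj-sym G (inj₁ u) (inj₁ v) e = E-sym G e
MAdj-sym G (inj₁ u) (inj₂ v) e = sym e
MAdj-sym G (inj₂ u) (inj₁ v) e = sym e

MAdj-irrefl : ∀ {n} (G : Graph n) a → ¬ MAdj G a a
MAdj-irrefl G (inj₁ u) e = irrefl G e
MAdj-irrefl G (inj₂ u) ()

pendant : ∀ {n} → Graph n → Graph (n + n)
pendant {n} G = record
  { E      = λ x y → MAdj G (splitAt n x) (splitAt n y)
  ; E-sym  = λ {x} {y} e → MAdj-sym G (splitAt n x) (splitAt n y) e
  ; irrefl = λ {x} e → MAdj-irrefl G (splitAt n x) e
  }

-- A tree decomposition of G becomes one of M(G) by putting v′ into every bag containing v, and
-- one of M(G) becomes one of G by forgetting the new vertices.  In the first, every edge of M(G)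
-- meeting a bag has an endpoint in G lying in that bag, and for an induced matching these
-- endpoints form an independent set of G.  In the second, an independent set I of G in a bag
-- yields the induced matching {vv′ : v ∈ I} meeting that bag.  So the α-width of G and the
-- μ-width of M(G) bound each other for every k, and the minima agree.
module Submission where

open import Defs
open import Data.Bool using (true; false)
open import Data.Empty using (⊥-elim)
open import Data.Fin using (Fin; zero; suc; splitAt; join; _↑ˡ_; _↑ʳ_)
open import Data.Fin.Properties using (suc-injective; ↑ˡ-injective; ↑ʳ-injective; splitAt-join; splitAt⁻¹-↑ˡ)
open import Data.Fin.Subset using (Subset; _∈_; ∣_∣; ⁅_⁆; _∪_; _-_) renaming (⊥ to ∅)
open import Data.Fin.Subset.Properties
  using (_∈?_; x∈p∪q⁺; x∈p∪q⁻; x∈⁅x⁆; x∈⁅y⁆⇒x≡y; ∉⊥; x∈p∧x≢y⇒x∈p-y; x∈p⇒∣p-x∣<∣p∣)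
open import Data.List using (List; []; _∷_; length; map; foldr)
open import Data.List.Properties using (length-map; map-∘)
open import Data.List.Relation.Unary.All using (All; []; _∷_)
import Data.List.Relation.Unary.All as All
open import Data.List.Relation.Unary.All.Properties using (map⁺)
open import Data.List.Relation.Unary.Any using (here; there)
open import Data.List.Relation.Unary.AllPairs using ([]; _∷_)
open import Data.List.Relation.Unary.Unique.Propositional using (Unique)
import Data.List.Relation.Unary.Unique.Propositional.Properties as Unique
import Data.List.Membership.Propositional as L
open import Data.List.Membership.Propositional.Properties using (∈-map⁺; ∈-map⁻)
open import Data.Nat using (ℕ; _+_; _≤_; z≤n)
open import Data.Nat.Properties using (≤-trans; ≤-<-trans)
open import Data.Product using (∃; _×_; _,_; proj₁; proj₂)
open import Data.Sum using (_⊎_; inj₁; inj₂; reduce; swap)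
open import Data.Vec using ([]; _∷_; tabulate; lookup) renaming (here to here∈; there to there∈)
open import Data.Vec.Properties using (lookup∘tabulate; []=⇒lookup; lookup⇒[]=)
open import Function using (_∘_)
open import Function.Bundles using (_⇔_; mk⇔; Equivalence)
open import Relation.Nullary using (¬_; yes; no)
open import Relation.Binary.PropositionalEquality
  using (_≡_; _≢_; refl; sym; trans; cong; subst)

private
  variable
    n N k : ℕ

fromList : List (Fin n) → Subset n
fromList = foldr (λ x p → ⁅ x ⁆ ∪ p) ∅

∈-fromList⁺ : ∀ {x : Fin n} {xs} → x L.∈ xs → x ∈ fromList xs
∈-fromList⁺ {xs = y ∷ _}  (here refl) = x∈p∪q⁺ (inj₁ (x∈⁅x⁆ y))
∈-fromList⁺ {xs = _ ∷ xs} (there x∈xs) = x∈p∪q⁺ (inj₂ (∈-fromList⁺ x∈xs))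

∈-fromList⁻ : ∀ {x : Fin n} xs → x ∈ fromList xs → x L.∈ xs
∈-fromList⁻ []       x∈∅ = ⊥-elim (∉⊥ x∈∅)
∈-fromList⁻ (y ∷ xs) x∈p with x∈p∪q⁻ ⁅ y ⁆ (fromList xs) x∈p
... | inj₁ x∈⁅y⁆ = here (x∈⁅y⁆⇒x≡y y x∈⁅y⁆)
... | inj₂ x∈xs  = there (∈-fromList⁻ xs x∈xs)

toList : Subset n → List (Fin n)
toList []          = []
toList (true ∷ p)  = zero ∷ map suc (toList p)
toList (false ∷ p) = map suc (toList p)

length-toList : (p : Subset n) → length (toList p) ≡ ∣ p ∣
length-toList []          = refl
length-toList (true ∷ p)  = cong ℕ.suc (trans (length-map suc (toList p)) (length-toList p))
length-toList (false ∷ p) = trans (length-map suc (toList p)) (length-toList p)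

∈-toList⁺ : ∀ {x : Fin n} p → x ∈ p → x L.∈ toList p
∈-toList⁺ (true ∷ p)  here∈ = here refl
∈-toList⁺ (true ∷ p)  (there∈ x∈p) = there (∈-map⁺ suc (∈-toList⁺ p x∈p))
∈-toList⁺ (false ∷ p) (there∈ x∈p) = ∈-map⁺ suc (∈-toList⁺ p x∈p)

∈-toList⁻ : ∀ {x : Fin n} p → x L.∈ toList p → x ∈ p
∈-toList⁻ (true ∷ p) (here refl) = here∈
∈-toList⁻ (true ∷ p) (there x∈) with ∈-map⁻ suc x∈
... | _ , y∈ , refl = there∈ (∈-toList⁻ p y∈)
∈-toList⁻ (false ∷ p) x∈ with ∈-map⁻ suc x∈
... | _ , y∈ , refl = there∈ (∈-toList⁻ p y∈)

toList-unique : (p : Subset n) → Unique (toList p)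
toList-unique []          = []
toList-unique (true ∷ p)  = All.tabulate zero∉ ∷ Unique.map⁺ suc-injective (toList-unique p)
  where
  zero∉ : ∀ {y} → y L.∈ map suc (toList p) → zero ≢ y
  zero∉ y∈ refl with ∈-map⁻ suc y∈
  ... | _ , _ , ()
toList-unique (false ∷ p) = Unique.map⁺ suc-injective (toList-unique p)

unique-length≤∣∣ : ∀ {xs} {p : Subset n} → Unique xs → All (_∈ p) xs → length xs ≤ ∣ p ∣
unique-length≤∣∣ []                 []               = z≤n
unique-length≤∣∣ {xs = x ∷ xs} {p} (x∉xs ∷ xs-unique) (x∈p ∷ xs⊆p) =
  ≤-<-trans (unique-length≤∣∣ xs-unique xs⊆p-x) (x∈p⇒∣p-x∣<∣p∣ x∈p)
  where
  xs⊆p-x : All (_∈ p - x) xs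
  xs⊆p-x = All.zipWith (λ (y∈p , x≢y) → x∈p∧x≢y⇒x∈p-y y∈p (x≢y ∘ sym)) (xs⊆p , x∉xs)

IndependentList : Graph n → List (Fin n) → Set
IndependentList G xs = ∀ {x y} → x L.∈ xs → y L.∈ xs → ¬ E G x y

αLeₗ : Graph n → Subset n → ℕ → Set
αLeₗ G S k = ∀ xs → Unique xs → All (_∈ S) xs → IndependentList G xs → length xs ≤ k

αLe⇒αLeₗ : ∀ {G : Graph n} {S} → αLe G S k → αLeₗ G S k
αLe⇒αLeₗ α xs xs-unique xs⊆S xs-indep =
  ≤-trans (unique-length≤∣∣ xs-unique (All.tabulate ∈-fromList⁺))
          (α (fromList xs) (All.lookup xs⊆S ∘ ∈-fromList⁻ xs)
             (λ x y x∈ y∈ → xs-indep (∈-fromList⁻ xs x∈) (∈-fromList⁻ xs y∈)))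

αLeₗ⇒αLe : ∀ {G : Graph n} {S} → αLeₗ G S k → αLe G S k
αLeₗ⇒αLe {k = k} α I I⊆S I-indep =
  subst (_≤ k) (length-toList I)
    (α (toList I) (toList-unique I) (All.tabulate (I⊆S ∘ ∈-toList⁻ I))
       (λ x∈ y∈ → I-indep _ _ (∈-toList⁻ I x∈) (∈-toList⁻ I y∈)))

IsEndpoint : Fin N → Fin N × Fin N → Set
IsEndpoint x (a , b) = (x ≡ a) ⊎ (x ≡ b)

∈-endpoints⁺ : ∀ {x : Fin N} {e M} → e L.∈ M → IsEndpoint x e → x L.∈ endpoints M
∈-endpoints⁺ (here refl) (inj₁ refl) = here refl
∈-endpoints⁺ (here refl) (inj₂ refl) = there (here refl)
∈-endpoints⁺ {M = _ ∷ _} (there e∈M) x∈e = there (there (∈-endpoints⁺ e∈M x∈e))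

∈-endpoints⁻ : ∀ {x : Fin N} M → x L.∈ endpoints M → ∃ λ e → e L.∈ M × IsEndpoint x e
∈-endpoints⁻ (_ ∷ _) (here refl)         = _ , here refl , inj₁ refl
∈-endpoints⁻ (_ ∷ _) (there (here refl)) = _ , here refl , inj₂ refl
∈-endpoints⁻ (_ ∷ M) (there (there x∈)) with ∈-endpoints⁻ M x∈
... | e , e∈M , x∈e = e , there e∈M , x∈e

endpoint-∉-tail : ∀ {a b x : Fin N} M → Unique (endpoints ((a , b) ∷ M)) →
                  IsEndpoint x (a , b) → ¬ x L.∈ endpoints M
endpoint-∉-tail M ((_ ∷ a∉) ∷ _) (inj₁ refl) x∈ = All.lookup a∉ x∈ refl
endpoint-∉-tail M (_ ∷ b∉ ∷ _)   (inj₂ refl) x∈ = All.lookup b∉ x∈ refl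

Unique-endpoints-tail : ∀ {a b : Fin N} M → Unique (endpoints ((a , b) ∷ M)) → Unique (endpoints M)
Unique-endpoints-tail M (_ ∷ _ ∷ u) = u

shared-endpoint⇒≡ : ∀ {x : Fin N} {e f} M → Unique (endpoints M) →
                    e L.∈ M → f L.∈ M → IsEndpoint x e → IsEndpoint x f → e ≡ f
shared-endpoint⇒≡ (_ ∷ M) u (here refl) (here refl) _ _ = refl
shared-endpoint⇒≡ (_ ∷ M) u (here refl) (there f∈M) x∈e x∈f =
  ⊥-elim (endpoint-∉-tail M u x∈e (∈-endpoints⁺ f∈M x∈f))
shared-endpoint⇒≡ (_ ∷ M) u (there e∈M) (here refl) x∈e x∈f =
  ⊥-elim (endpoint-∉-tail M u x∈f (∈-endpoints⁺ e∈M x∈e))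
shared-endpoint⇒≡ (_ ∷ M) u (there e∈M) (there f∈M) x∈e x∈f =
  shared-endpoint⇒≡ M (Unique-endpoints-tail M u) e∈M f∈M x∈e x∈f

IsEdge : Graph N → Fin N × Fin N → Set
IsEdge H (a , b) = E H a b

Unique-endpoints⁺ : ∀ {H : Graph N} M → All (IsEdge H) M → Unique M →
                    (∀ {x e f} → e L.∈ M → f L.∈ M → IsEndpoint x e → IsEndpoint x f → e ≡ f) →
                    Unique (endpoints M)
Unique-endpoints⁺ []            []          []            _     = []
Unique-endpoints⁺ {H = H} ((a , b) ∷ M) (ab ∷ edges) (ab∉M ∷ M-unique) share =
  (a≢b ∷ ∉tail (inj₁ refl)) ∷ ∉tail (inj₂ refl) ∷
  Unique-endpoints⁺ {H = H} M edges M-unique (λ e∈ f∈ → share (there e∈) (there f∈))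
  where
  a≢b : a ≢ b
  a≢b refl = irrefl H ab
  ∉tail : ∀ {x} → IsEndpoint x (a , b) → All (x ≢_) (endpoints M)
  ∉tail x∈ab = All.tabulate λ x∈ x≡y → shared⇒⊥ x∈ab (subst (L._∈ endpoints M) (sym x≡y) x∈)
    where
    shared⇒⊥ : ∀ {x} → IsEndpoint x (a , b) → ¬ x L.∈ endpoints M
    shared⇒⊥ x∈ab x∈ with ∈-endpoints⁻ M x∈
    ... | f , f∈M , x∈f = All.lookup ab∉M f∈M (share (here refl) (there f∈M) x∈ab x∈f)

Unique-map-endpoint : ∀ (c : Fin N × Fin N → Fin N) M → All (λ e → IsEndpoint (c e) e) M →
                      Unique (endpoints M) → Unique (map c M)
Unique-map-endpoint c []            []           _ = []
Unique-map-endpoint c ((a , b) ∷ M) (c∈ab ∷ c∈M) u =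
  All.tabulate c-fresh ∷ Unique-map-endpoint c M c∈M (Unique-endpoints-tail M u)
  where
  c-fresh : ∀ {y} → y L.∈ map c M → c (a , b) ≢ y
  c-fresh y∈ c≡y with ∈-map⁻ c y∈
  ... | f , f∈M , refl =
    endpoint-∉-tail M u c∈ab (∈-endpoints⁺ f∈M (subst (λ z → IsEndpoint z f) (sym c≡y) (All.lookup c∈M f∈M)))

InducedMatching-adjacent⇒≡ : ∀ {H : Graph N} {M e f x y} → InducedMatching H M →
                             e L.∈ M → f L.∈ M → IsEndpoint x e → IsEndpoint y f → E H x y → e ≡ f
InducedMatching-adjacent⇒≡ {M = M} (_ , u , induced) e∈M f∈M x∈e y∈f xy
  with induced _ _ (∈-endpoints⁺ e∈M x∈e) (∈-endpoints⁺ f∈M y∈f) xy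
... | inj₁ xy∈M = trans (shared-endpoint⇒≡ M u e∈M xy∈M x∈e (inj₁ refl))
                        (shared-endpoint⇒≡ M u xy∈M f∈M (inj₂ refl) y∈f)
... | inj₂ yx∈M = trans (shared-endpoint⇒≡ M u e∈M yx∈M x∈e (inj₂ refl))
                        (shared-endpoint⇒≡ M u yx∈M f∈M (inj₁ refl) y∈f)

-- The chosen endpoints of an induced matching are distinct and pairwise non-adjacent.
μLe-from-transversal : ∀ {G : Graph n} {H : Graph N} {S B} (ι : Fin n → Fin N) (c : Fin N × Fin N → Fin n) →
  (∀ {u v} → E G u v → E H (ι u) (ι v)) →
  (∀ {a b} → E H a b → a ∈ S ⊎ b ∈ S → IsEndpoint (ι (c (a , b))) (a , b) × c (a , b) ∈ B) →
  αLeₗ G B k → μLe H S k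
μLe-from-transversal {k = k} {G = G} {H = H} {B = B} ι c ι-edge transversal α M matching@(edges , u , _) hits =
  subst (_≤ k) (length-map c M) (α (map c M) c-unique (map⁺ (All.map proj₂ chosen)) c-indep)
  where
  chosen : All (λ e → IsEndpoint (ι (c e)) e × c e ∈ B) M
  chosen = All.zipWith (λ (ab , hit) → transversal ab hit) (edges , hits)
  c-unique : Unique (map c M)
  c-unique = Unique.map⁻ {f = ι} (subst Unique (map-∘ M) (Unique-map-endpoint (ι ∘ c) M (All.map proj₁ chosen) u))
  c-indep : IndependentList G (map c M)
  c-indep x∈ y∈ xy with ∈-map⁻ c x∈ | ∈-map⁻ c y∈
  ... | e , e∈M , refl | f , f∈M , refl
    with refl ← InducedMatching-adjacent⇒≡ {H = H} matching e∈M f∈M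
                  (proj₁ (All.lookup chosen e∈M)) (proj₁ (All.lookup chosen f∈M)) (ι-edge xy)
    = irrefl G xy

preimage : (Fin N → Fin n) → Subset n → Subset N
preimage f p = tabulate (λ x → lookup p (f x))

∈-preimage⁺ : ∀ {f : Fin N → Fin n} {p x} → f x ∈ p → x ∈ preimage f p
∈-preimage⁺ {x = x} fx∈p = lookup⇒[]= x _ (trans (lookup∘tabulate _ x) ([]=⇒lookup fx∈p))

∈-preimage⁻ : ∀ {f : Fin N → Fin n} {p x} → x ∈ preimage f p → f x ∈ p
∈-preimage⁻ {f = f} {p} {x} x∈ = lookup⇒[]= (f x) p (trans (sym (lookup∘tabulate _ x)) ([]=⇒lookup x∈))

Walk-map : ∀ {m} {T : Graph m} {P Q : Fin m → Set} → (∀ {t} → P t → Q t) →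
           ∀ {s t} → Walk T P s t → Walk T Q s t
Walk-map P⇒Q (here Ps)        = here (P⇒Q Ps)
Walk-map P⇒Q (step Ps st walk) = step (P⇒Q Ps) st (Walk-map P⇒Q walk)

ConnectedIn-⇔ : ∀ {m} {T : Graph m} {P Q : Fin m → Set} → (∀ {t} → P t ⇔ Q t) →
                ConnectedIn T P → ConnectedIn T Q
ConnectedIn-⇔ P⇔Q ((t , Pt) , walks) =
  (t , to P⇔Q Pt) , λ s t Qs Qt → Walk-map (to P⇔Q) (walks s t (from P⇔Q Qs) (from P⇔Q Qt))
  where open Equivalence

pullback : ∀ {G : Graph n} {H : Graph N} (D : TreeDecomposition G) (f : Fin N → Fin n) →
           (∀ x y → E H x y → ∃ λ t → f x ∈ bag D t × f y ∈ bag D t) → TreeDecomposition H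
pullback D f edge-covered = record
  { m       = m D
  ; T       = T D
  ; isTree  = isTree D
  ; bag     = λ t → preimage f (bag D t)
  ; vertexC = λ x → ConnectedIn-⇔ (mk⇔ ∈-preimage⁺ ∈-preimage⁻) (vertexC D (f x))
  ; edgeC   = λ x y xy → let t , fx∈ , fy∈ = edge-covered x y xy in t , ∈-preimage⁺ fx∈ , ∈-preimage⁺ fy∈
  }

IsTw-⇔ : ∀ {κ ν : Measure} {G : Graph n} {H : Graph N} →
         (∀ k → TwLe κ G k ⇔ TwLe ν H k) → ∀ k → IsTw κ G k ⇔ IsTw ν H k
IsTw-⇔ tw⇔ k = mk⇔
  (λ (κ-tw , least) → to (tw⇔ k) κ-tw , λ k′ ν-tw → least k′ (from (tw⇔ k′) ν-tw))
  (λ (ν-tw , least) → from (tw⇔ k) ν-tw , λ k′ κ-tw → least k′ (to (tw⇔ k′) κ-tw))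
  where open Equivalence

module _ {n} (G : Graph n) where

  base : Fin (n + n) → Fin n
  base x = reduce (splitAt n x)

  pendant-join⁻ : ∀ a b → E (pendant G) (join n n a) (join n n b) → MAdj G a b
  pendant-join⁻ a b rewrite splitAt-join n n a | splitAt-join n n b = λ ab → ab

  pendant-join⁺ : ∀ a b → MAdj G a b → E (pendant G) (join n n a) (join n n b)
  pendant-join⁺ a b rewrite splitAt-join n n a | splitAt-join n n b = λ ab → ab

  pendant-edge-bases : ∀ x y → E (pendant G) x y → E G (base x) (base y) ⊎ base x ≡ base y
  pendant-edge-bases x y xy with splitAt n x | splitAt n y
  ... | inj₁ u | inj₁ v = inj₁ xy
  ... | inj₁ u | inj₂ v = inj₂ xy
  ... | inj₂ u | inj₁ v = inj₂ xy
  ... | inj₂ u | inj₂ v = ⊥-elim xy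

  base-endpoint : ∀ x y → E (pendant G) x y → IsEndpoint (base x ↑ˡ n) (x , y)
  base-endpoint x y xy with splitAt n x in x≡ | splitAt n y in y≡
  ... | inj₁ u | _      = inj₁ (splitAt⁻¹-↑ˡ x≡)
  ... | inj₂ u | inj₁ v = inj₂ (trans (cong (_↑ˡ n) xy) (splitAt⁻¹-↑ˡ y≡))
  ... | inj₂ u | inj₂ v = ⊥-elim xy

  αtw⇒μtw : TwLe αLe G k → TwLe μLe (pendant G) k
  αtw⇒μtw (D , α-width) =
    D′ , λ t → μLe-from-transversal {G = G} {H = pendant G} {B = bag D t} (_↑ˡ n) (chosen-base t)
                 (pendant-join⁺ (inj₁ _) (inj₁ _)) (transversal t) (αLe⇒αLeₗ {G = G} (α-width t))
    where
    edge-covered : ∀ x y → E (pendant G) x y → ∃ λ t → base x ∈ bag D t × base y ∈ bag D t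
    edge-covered x y xy with pendant-edge-bases x y xy
    ... | inj₁ bxby  = edgeC D _ _ bxby
    ... | inj₂ bx≡by = let (t , bx∈) , _ = vertexC D (base x) in t , bx∈ , subst (_∈ bag D t) bx≡by bx∈

    D′ : TreeDecomposition (pendant G)
    D′ = pullback D base edge-covered

    chosen-base : Fin (m D) → Fin (n + n) × Fin (n + n) → Fin n
    chosen-base t (a , b) with a ∈? bag D′ t
    ... | yes _ = base a
    ... | no  _ = base b

    transversal : ∀ t {a b} → E (pendant G) a b → a ∈ bag D′ t ⊎ b ∈ bag D′ t →
                  IsEndpoint (chosen-base t (a , b) ↑ˡ n) (a , b) × chosen-base t (a , b) ∈ bag D t
    transversal t {a} {b} ab hit with a ∈? bag D′ t | hit
    ... | yes a∈ | _      = base-endpoint a b ab , ∈-preimage⁻ a∈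
    ... | no  a∉ | inj₁ a∈ = ⊥-elim (a∉ a∈)
    ... | no  _  | inj₂ b∈ = swap (base-endpoint b a (E-sym (pendant G) ab)) , ∈-preimage⁻ b∈

  spoke : Fin n → Fin (n + n) × Fin (n + n)
  spoke u = u ↑ˡ n , n ↑ʳ u

  ↑ˡ≢↑ʳ : ∀ u v → u ↑ˡ n ≢ n ↑ʳ v
  ↑ˡ≢↑ʳ u v eq with trans (sym (splitAt-join n n (inj₁ u))) (trans (cong (splitAt n) eq) (splitAt-join n n (inj₂ v)))
  ... | ()

  spokes-share⇒≡ : ∀ {x u v} → IsEndpoint x (spoke u) → IsEndpoint x (spoke v) → u ≡ v
  spokes-share⇒≡ {u = u} {v} (inj₁ refl) (inj₁ eq) = ↑ˡ-injective n u v eq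
  spokes-share⇒≡ {u = u} {v} (inj₁ refl) (inj₂ eq) = ⊥-elim (↑ˡ≢↑ʳ u v eq)
  spokes-share⇒≡ {u = u} {v} (inj₂ refl) (inj₁ eq) = ⊥-elim (↑ˡ≢↑ʳ v u (sym eq))
  spokes-share⇒≡ {u = u} {v} (inj₂ refl) (inj₂ eq) = ↑ʳ-injective n u v eq

  ∈-spoke-endpoints⁻ : ∀ {x} xs → x L.∈ endpoints (map spoke xs) → ∃ λ u → u L.∈ xs × IsEndpoint x (spoke u)
  ∈-spoke-endpoints⁻ xs x∈ with ∈-endpoints⁻ (map spoke xs) x∈
  ... | e , e∈ , x∈e with ∈-map⁻ spoke e∈
  ...   | u , u∈ , refl = u , u∈ , x∈e

  spokes-inducedMatching : ∀ {xs} → Unique xs → IndependentList G xs → InducedMatching (pendant G) (map spoke xs)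
  spokes-inducedMatching {xs} xs-unique xs-indep =
    edges , Unique-endpoints⁺ {H = pendant G} (map spoke xs) edges spokes-unique share , induced
    where
    edges : All (IsEdge (pendant G)) (map spoke xs)
    edges = map⁺ (All.tabulate λ {u} _ → pendant-join⁺ (inj₁ u) (inj₂ u) refl)

    spokes-unique : Unique (map spoke xs)
    spokes-unique = Unique.map⁺ (λ {u} {v} eq → ↑ˡ-injective n u v (cong proj₁ eq)) xs-unique

    share : ∀ {x e f} → e L.∈ map spoke xs → f L.∈ map spoke xs → IsEndpoint x e → IsEndpoint x f → e ≡ f
    share e∈ f∈ x∈e x∈f with ∈-map⁻ spoke e∈ | ∈-map⁻ spoke f∈
    ... | _ , _ , refl | _ , _ , refl = cong spoke (spokes-share⇒≡ x∈e x∈f)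

    induced : ∀ x y → x L.∈ endpoints (map spoke xs) → y L.∈ endpoints (map spoke xs) → E (pendant G) x y →
              (x , y) L.∈ map spoke xs ⊎ (y , x) L.∈ map spoke xs
    induced x y x∈ y∈ xy with ∈-spoke-endpoints⁻ xs x∈ | ∈-spoke-endpoints⁻ xs y∈
    ... | u , u∈ , inj₁ refl | v , v∈ , inj₁ refl = ⊥-elim (xs-indep u∈ v∈ (pendant-join⁻ (inj₁ u) (inj₁ v) xy))
    ... | u , u∈ , inj₁ refl | v , v∈ , inj₂ refl with refl ← pendant-join⁻ (inj₁ u) (inj₂ v) xy = inj₁ (∈-map⁺ spoke u∈)
    ... | u , u∈ , inj₂ refl | v , v∈ , inj₁ refl with refl ← pendant-join⁻ (inj₂ u) (inj₁ v) xy = inj₂ (∈-map⁺ spoke u∈)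
    ... | u , u∈ , inj₂ refl | v , v∈ , inj₂ refl = ⊥-elim (pendant-join⁻ (inj₂ u) (inj₂ v) xy)

  μtw⇒αtw : TwLe μLe (pendant G) k → TwLe αLe G k
  μtw⇒αtw {k} (D , μ-width) =
    pullback D (_↑ˡ n) (λ u v uv → edgeC D _ _ (pendant-join⁺ (inj₁ u) (inj₁ v) uv)) ,
    λ t → αLeₗ⇒αLe {G = G} λ xs xs-unique xs⊆ xs-indep →
      subst (_≤ k) (length-map spoke xs)
        (μ-width t (map spoke xs) (spokes-inducedMatching xs-unique xs-indep)
           (map⁺ (All.map (inj₁ ∘ ∈-preimage⁻) xs⊆)))

mainTheorem6 : ∀ {n} (G : Graph n) (k : ℕ) → α-tw≡ G k ⇔ μ-tw≡ (pendant G) k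
mainTheorem6 G = IsTw-⇔ {κ = αLe} {ν = μLe} λ _ → mk⇔ (αtw⇒μtw G) (μtw⇒αtw G)
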